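{- Let $v$ be a finite Fibonacci word and let $d_1(v)$ denote the smallest position of a 2 in $v$. If $d_1(v)\ne2$ (including the case that $v$ has no 2), then $|\pi_2(v)|\ge\pi(v)^4$; if $d_1(v)=2$, then $|\pi_3(v)|\ge\pi(v)^9$.
   Context: Fibonacci words: finite words in $\{1,2\}$; rank $|v|$ = sum of digits; the position of the 2 in $v=v_12v_2$ is $|v_2|+1$. For a word $v$ whose 2's are at positions $d_1<d_2<\cdots$: $\pi(v)=\prod_{j:d_j\ge2}(1-1/d_j)$ and, for $k\ge2$, $\pi_k(v)=\prod_{j:d_j\ge k-1}(1-k/d_j)$. -}

module Defs where

open import Data.Nat as ℕ using (ℕ; zero; suc)
open import Data.Integer using (+_)
open import Data.List using (List; []; _∷_; foldr)
open import Data.Maybe using (Maybe; just; nothing; maybe)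
open import Data.Rational using (ℚ; 1ℚ; _-_; _*_; _/_)
open import Data.Bool using (true; false)

data Digit : Set where
  one two : Digit

digitValue : Digit → ℕ
digitValue one = 1
digitValue two = 2

-- A finite Fibonacci word, written left to right (head = leftmost letter).
FibWord : Set
FibWord = List Digit

rank : FibWord → ℕ
rank [] = 0
rank (x ∷ v) = digitValue x ℕ.+ rank v

positions : FibWord → List ℕ
positions [] = []
positions (one ∷ v) = positions v
positions (two ∷ v) = suc (rank v) ∷ positions v

d₁ : FibWord → Maybe ℕ
d₁ v = foldr (λ d m → just (maybe (ℕ._⊓ d) d m)) nothing (positions v)

-- the factor (1 - k/d) (positions are always ≥ 1; d = 0 never occurs)
factor : ℕ → ℕ → ℚ
factor k zero = 1ℚ
factor k (suc n) = 1ℚ - ((+ k) / suc n)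

prodFrom : ℕ → (ℕ → ℚ) → List ℕ → ℚ
prodFrom m f [] = 1ℚ
prodFrom m f (d ∷ ds) with m ℕ.≤ᵇ d
... | true = f d * prodFrom m f ds
... | false = prodFrom m f ds

π : FibWord → ℚ
π v = prodFrom 2 (factor 1) (positions v)

π[_] : ℕ → FibWord → ℚ
π[ k ] v = prodFrom (k ℕ.∸ 1) (factor k) (positions v)

infixr 8 _^_
_^_ : ℚ → ℕ → ℚ
q ^ zero = 1ℚ
q ^ suc n = q * (q ^ n)

-- Both sides are products over the positions d of the 2's in v, so it suffices to compare
-- them factor by factor: (1 - 1/d)⁴ ≤ 1 - 2/d for d ≥ 3, and
-- (1 - 1/d)⁹ ≤ (1 - 1/d)⁸ ≤ (1 - 2/d)² ≤ 1 - 3/d for d ≥ 4, after cross-multiplying.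
-- The comparison only fails at d = 2 for π₂ and at d = 3 for π₃, where the right-hand
-- factor vanishes. Each 2 has rank 2, so two positions never differ by 1: if d₁(v) ≠ 2
-- then 2 is not a position (the only smaller candidate, 1, is its neighbour), and if
-- d₁(v) = 2 then 3 is not a position.
{-# OPTIONS --safe #-}
module Submission where

open import Defs
open import Algebra.Bundles using (CommutativeMonoid)
open import Data.Bool using (true; false; if_then_else_; T)
open import Data.Integer as ℤ using (+_)
import Data.Integer.Properties as ℤ
open import Data.Integer.Tactic.RingSolver as ℤ-Solver using ()
open import Data.List using (List; []; _∷_; foldr)
open import Data.List.Membership.Propositional using (_∈_; _∉_)
open import Data.List.Relation.Unary.All as All using (All; []; _∷_)
open import Data.List.Relation.Unary.Any using (here; there)
open import Data.Maybe using (Maybe; just; nothing; maybe)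
open import Data.Maybe.Properties using (just-injective)
open import Data.Nat as ℕ using (ℕ; zero; suc; NonZero; z≤n; s≤s)
import Data.Nat.Properties as ℕ
open import Data.Nat.Solver using (module +-*-Solver)
open import Data.Product using (_×_; _,_; ∃-syntax)
open import Data.Rational
  using (ℚ; 0ℚ; 1ℚ; _/_; _*_; -_; _-_; _≤_; _≥_; ∣_∣; toℚᵘ; nonNegative)
import Data.Rational.Properties as ℚ
open import Data.Rational.Unnormalised as ℚᵘ using (*≤*)
import Data.Rational.Unnormalised.Properties as ℚᵘ
open import Data.Sum using (inj₁; inj₂)
open import Relation.Binary.PropositionalEquality
open import Relation.Nullary using (contradiction)
open import Relation.Nullary.Decidable using (toWitness)

toℚᵘ-/ : ∀ i n .{{_ : NonZero n}} → toℚᵘ (i / n) ℚᵘ.≃ i ℚᵘ./ n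
toℚᵘ-/ i (suc n) = ℚ.toℚᵘ-fromℚᵘ (i ℚᵘ./ suc n)

*≤*⇒/≤/ : ∀ {a b m n} .{{_ : NonZero m}} .{{_ : NonZero n}} →
           a ℕ.* n ℕ.≤ b ℕ.* m → + a / m ≤ + b / n
*≤*⇒/≤/ {a} {b} {m@(suc _)} {n@(suc _)} an≤bm = ℚ.toℚᵘ-cancel-≤
  (ℚᵘ.≤-respˡ-≃ (ℚᵘ.≃-sym (toℚᵘ-/ (+ a) m)) (ℚᵘ.≤-respʳ-≃ (ℚᵘ.≃-sym (toℚᵘ-/ (+ b) n))
    (*≤* (subst₂ ℤ._≤_ (ℤ.pos-* a n) (ℤ.pos-* b m) (ℤ.+≤+ an≤bm)))))

/-*-/ : ∀ a b m n .{{_ : NonZero m}} .{{_ : NonZero n}} →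
        (+ a / m) * (+ b / n) ≡ (+ (a ℕ.* b) / (m ℕ.* n)) {{ℕ.m*n≢0 m n}}
/-*-/ a b m@(suc _) n@(suc _) = ℚ.toℚᵘ-injective (begin
  toℚᵘ ((+ a / m) * (+ b / n))            ≈⟨ ℚ.toℚᵘ-homo-* (+ a / m) (+ b / n) ⟩
  toℚᵘ (+ a / m) ℚᵘ.* toℚᵘ (+ b / n)      ≈⟨ ℚᵘ.*-cong (toℚᵘ-/ (+ a) m) (toℚᵘ-/ (+ b) n) ⟩
  (+ a ℤ.* + b) ℚᵘ./ (m ℕ.* n)            ≡⟨ cong (ℚᵘ._/ (m ℕ.* n)) (ℤ.pos-* a b) ⟨
  + (a ℕ.* b) ℚᵘ./ (m ℕ.* n)              ≈⟨ toℚᵘ-/ (+ (a ℕ.* b)) (m ℕ.* n) ⟨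
  toℚᵘ (+ (a ℕ.* b) / (m ℕ.* n))          ∎)
  where open ℚᵘ.≃-Reasoning

/-^ : ∀ a n k .{{_ : NonZero n}} → (+ a / n) ^ k ≡ (+ (a ℕ.^ k) / (n ℕ.^ k)) {{ℕ.m^n≢0 n k}}
/-^ a n zero = refl
/-^ a n (suc k) {{n≢0}} =
  trans (cong ((+ a / n) *_) (/-^ a n k)) (/-*-/ a (a ℕ.^ k) n (n ℕ.^ k) {{n≢0}} {{ℕ.m^n≢0 n k}})

factor≡/ : ∀ k d .{{_ : NonZero d}} → k ℕ.≤ d → factor k d ≡ + (d ℕ.∸ k) / d
factor≡/ k d@(suc _) k≤d = ℚ.toℚᵘ-injective (begin
  toℚᵘ (1ℚ - + k / d)                  ≈⟨ ℚ.toℚᵘ-homo-+ 1ℚ (- (+ k / d)) ⟩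
  toℚᵘ 1ℚ ℚᵘ.+ toℚᵘ (- (+ k / d))      ≈⟨ ℚᵘ.+-congʳ (toℚᵘ 1ℚ) (ℚ.toℚᵘ-homo‿- (+ k / d)) ⟩
  ℚᵘ.1ℚᵘ ℚᵘ.- toℚᵘ (+ k / d)           ≈⟨ ℚᵘ.+-congʳ ℚᵘ.1ℚᵘ (ℚᵘ.-‿cong (toℚᵘ-/ (+ k) d)) ⟩
  ℚᵘ.1ℚᵘ ℚᵘ.- (+ k ℚᵘ./ d)             ≈⟨ ℚᵘ.*≡* cross-multiplied ⟩
  + (d ℕ.∸ k) ℚᵘ./ d                   ≈⟨ toℚᵘ-/ (+ (d ℕ.∸ k)) d ⟨
  toℚᵘ (+ (d ℕ.∸ k) / d)               ∎)
  where
  open ℚᵘ.≃-Reasoning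
  -- ℚᵘ unfolds 1 - k/d to (1·d + (-k)·1) / (1·d).
  [1*D-K*1]*D≡[D-K]*D : ∀ D K → (+ 1 ℤ.* D ℤ.+ ℤ.- K ℤ.* + 1) ℤ.* D ≡ (D ℤ.- K) ℤ.* D
  [1*D-K*1]*D≡[D-K]*D = ℤ-Solver.solve-∀
  cross-multiplied : (+ 1 ℤ.* + d ℤ.+ ℤ.- + k ℤ.* + 1) ℤ.* + d ≡ + (d ℕ.∸ k) ℤ.* + (1 ℕ.* d)
  cross-multiplied = trans ([1*D-K*1]*D≡[D-K]*D (+ d) (+ k))
    (cong₂ ℤ._*_ (trans (ℤ.m-n≡m⊖n d k) (ℤ.⊖-≥ k≤d)) (cong +_ (sym (ℕ.*-identityˡ d))))

factor-nonNeg : ∀ {k} d → k ℕ.≤ d → 0ℚ ≤ factor k d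
factor-nonNeg         zero    _   = ℚ.nonNegative⁻¹ 1ℚ
factor-nonNeg {k} d@(suc _) k≤d =
  subst (0ℚ ≤_) (sym (factor≡/ k d k≤d)) (*≤*⇒/≤/ {0} {d ℕ.∸ k} {1} {d} z≤n)

∣factor∣≡factor : ∀ {k} d → k ℕ.≤ d → ∣ factor k d ∣ ≡ factor k d
∣factor∣≡factor d k≤d = ℚ.0≤p⇒∣p∣≡p (factor-nonNeg d k≤d)

factor-^-≤ : ∀ {i j} k d .{{_ : NonZero d}} → i ℕ.≤ d → j ℕ.≤ d →
             (d ℕ.∸ i) ℕ.^ k ℕ.* d ℕ.≤ (d ℕ.∸ j) ℕ.* d ℕ.^ k →
             factor i d ^ k ≤ factor j d
factor-^-≤ {i} {j} k d i≤d j≤d cross = begin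
  factor i d ^ k                                   ≡⟨ cong (_^ k) (factor≡/ i d i≤d) ⟩
  (+ (d ℕ.∸ i) / d) ^ k                            ≡⟨ /-^ (d ℕ.∸ i) d k ⟩
  (+ ((d ℕ.∸ i) ℕ.^ k) / d ℕ.^ k) {{ℕ.m^n≢0 d k}}  ≤⟨ *≤*⇒/≤/ {(d ℕ.∸ i) ℕ.^ k} {d ℕ.∸ j} {d ℕ.^ k} {d}
                                                           {{ℕ.m^n≢0 d k}} cross ⟩
  + (d ℕ.∸ j) / d                                  ≡⟨ factor≡/ j d j≤d ⟨
  factor j d                                       ∎
  where open ℚ.≤-Reasoning

[d-1]⁴d≤[d-2]d⁴ : ∀ d → 3 ℕ.≤ d → (d ℕ.∸ 1) ℕ.^ 4 ℕ.* d ℕ.≤ (d ℕ.∸ 2) ℕ.* d ℕ.^ 4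
[d-1]⁴d≤[d-2]d⁴ (suc (suc (suc n))) (s≤s (s≤s (s≤s _))) = ℕ.≤-trans (ℕ.m≤m+n _ _) (ℕ.≤-reflexive (sym (expand n)))
  where
  open +-*-Solver
  expand : ∀ n → (1 ℕ.+ n) ℕ.* (3 ℕ.+ n) ℕ.^ 4
               ≡ (2 ℕ.+ n) ℕ.^ 4 ℕ.* (3 ℕ.+ n) ℕ.+ (3 ℕ.+ n) ℕ.* (11 ℕ.+ 22 ℕ.* n ℕ.+ 12 ℕ.* n ℕ.^ 2 ℕ.+ 2 ℕ.* n ℕ.^ 3)
  expand = solve 1 (λ n → (con 1 :+ n) :* (con 3 :+ n) :^ 4
                       := (con 2 :+ n) :^ 4 :* (con 3 :+ n)
                          :+ (con 3 :+ n) :* (con 11 :+ con 22 :* n :+ con 12 :* n :^ 2 :+ con 2 :* n :^ 3)) refl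

[d-2]²≤[d-3]d : ∀ d → 4 ℕ.≤ d → (d ℕ.∸ 2) ℕ.^ 2 ℕ.≤ (d ℕ.∸ 3) ℕ.* d
[d-2]²≤[d-3]d (suc (suc (suc (suc n)))) (s≤s (s≤s (s≤s (s≤s _)))) = ℕ.≤-trans (ℕ.m≤m+n _ n) (ℕ.≤-reflexive (sym (expand n)))
  where
  open +-*-Solver
  expand : ∀ n → (1 ℕ.+ n) ℕ.* (4 ℕ.+ n) ≡ (2 ℕ.+ n) ℕ.^ 2 ℕ.+ n
  expand = solve 1 (λ n → (con 1 :+ n) :* (con 4 :+ n) := (con 2 :+ n) :^ 2 :+ n) refl

[d-1]⁹d≤[d-3]d⁹ : ∀ d → 4 ℕ.≤ d → (d ℕ.∸ 1) ℕ.^ 9 ℕ.* d ℕ.≤ (d ℕ.∸ 3) ℕ.* d ℕ.^ 9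
[d-1]⁹d≤[d-3]d⁹ d 4≤d = begin
  a ℕ.^ 9 ℕ.* d            ≡⟨ ℕ.*-assoc a (a ℕ.^ 8) d ⟩
  a ℕ.* (a ℕ.^ 8 ℕ.* d)    ≤⟨ ℕ.*-monoˡ-≤ (a ℕ.^ 8 ℕ.* d) (ℕ.m∸n≤m d 1) ⟩
  d ℕ.* (a ℕ.^ 8 ℕ.* d)    ≡⟨ regroup a d ⟩
  (a ℕ.^ 4 ℕ.* d) ℕ.^ 2    ≤⟨ ℕ.^-monoˡ-≤ 2 ([d-1]⁴d≤[d-2]d⁴ d (ℕ.≤-trans (ℕ.n≤1+n 3) 4≤d)) ⟩
  (b ℕ.* d ℕ.^ 4) ℕ.^ 2    ≡⟨ distribute b d ⟩
  b ℕ.^ 2 ℕ.* d ℕ.^ 8      ≤⟨ ℕ.*-monoˡ-≤ (d ℕ.^ 8) ([d-2]²≤[d-3]d d 4≤d) ⟩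
  (c ℕ.* d) ℕ.* d ℕ.^ 8    ≡⟨ ℕ.*-assoc c d (d ℕ.^ 8) ⟩
  c ℕ.* d ℕ.^ 9            ∎
  where
  open ℕ.≤-Reasoning
  open +-*-Solver
  a = d ℕ.∸ 1
  b = d ℕ.∸ 2
  c = d ℕ.∸ 3
  regroup : ∀ a d → d ℕ.* (a ℕ.^ 8 ℕ.* d) ≡ (a ℕ.^ 4 ℕ.* d) ℕ.^ 2
  regroup = solve 2 (λ a d → d :* (a :^ 8 :* d) := (a :^ 4 :* d) :^ 2) refl
  distribute : ∀ b d → (b ℕ.* d ℕ.^ 4) ℕ.^ 2 ≡ b ℕ.^ 2 ℕ.* d ℕ.^ 8
  distribute = solve 2 (λ b d → (b :* d :^ 4) :^ 2 := b :^ 2 :* d :^ 8) refl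

^-distrib-* : ∀ p q n → (p * q) ^ n ≡ p ^ n * q ^ n
^-distrib-* p q zero    = refl
^-distrib-* p q (suc n) = trans (cong ((p * q) *_) (^-distrib-* p q n)) (interchange p q (p ^ n) (q ^ n))
  where open import Algebra.Properties.CommutativeSemigroup
          (CommutativeMonoid.commutativeSemigroup ℚ.*-1-commutativeMonoid) using (interchange)

1^n≡1 : ∀ n → 1ℚ ^ n ≡ 1ℚ
1^n≡1 zero    = refl
1^n≡1 (suc n) = trans (ℚ.*-identityˡ (1ℚ ^ n)) (1^n≡1 n)

*-mono-≤-nonNeg : ∀ {p q r s} → 0ℚ ≤ p → 0ℚ ≤ s → p ≤ q → r ≤ s → p * r ≤ q * s
*-mono-≤-nonNeg {p} {q} {r} {s} 0≤p 0≤s p≤q r≤s = ℚ.≤-trans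
  (ℚ.*-monoˡ-≤-nonNeg p {{nonNegative 0≤p}} r≤s)
  (ℚ.*-monoʳ-≤-nonNeg s {{nonNegative 0≤s}} p≤q)

^-nonNeg : ∀ {p} n → 0ℚ ≤ p → 0ℚ ≤ p ^ n
^-nonNeg zero    _   = ℚ.nonNegative⁻¹ 1ℚ
^-nonNeg (suc n) 0≤p = *-mono-≤-nonNeg ℚ.≤-refl (^-nonNeg n 0≤p) 0≤p (^-nonNeg n 0≤p)

factorFrom : ℕ → (ℕ → ℚ) → ℕ → ℚ
factorFrom m f d = if m ℕ.≤ᵇ d then f d else 1ℚ

prodFrom-∷ : ∀ m f d ds → prodFrom m f (d ∷ ds) ≡ factorFrom m f d * prodFrom m f ds
prodFrom-∷ m f d ds with m ℕ.≤ᵇ d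
... | true  = refl
... | false = sym (ℚ.*-identityˡ (prodFrom m f ds))

factorFrom-nonNeg : ∀ {m f} → (∀ {d} → m ℕ.≤ d → 0ℚ ≤ f d) → ∀ d → 0ℚ ≤ factorFrom m f d
factorFrom-nonNeg {m} f≥0 d with m ℕ.≤ᵇ d in m≤ᵇd
... | true  = f≥0 (ℕ.≤ᵇ⇒≤ m d (subst T (sym m≤ᵇd) _))
... | false = ℚ.nonNegative⁻¹ 1ℚ

prodFrom-^-≤-∣prodFrom∣ : ∀ {m m′ f g} k ds → (∀ {d} → m ℕ.≤ d → 0ℚ ≤ f d) →
                          All (λ d → factorFrom m f d ^ k ≤ ∣ factorFrom m′ g d ∣) ds →
                          prodFrom m f ds ^ k ≤ ∣ prodFrom m′ g ds ∣
prodFrom-^-≤-∣prodFrom∣ k []       _   []         = ℚ.≤-reflexive (1^n≡1 k)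
prodFrom-^-≤-∣prodFrom∣ {m} {m′} {f} {g} k (d ∷ ds) f≥0 (d≤ ∷ ds≤) = begin
  prodFrom m f (d ∷ ds) ^ k                     ≡⟨ cong (_^ k) (prodFrom-∷ m f d ds) ⟩
  (factorFrom m f d * prodFrom m f ds) ^ k      ≡⟨ ^-distrib-* (factorFrom m f d) (prodFrom m f ds) k ⟩
  factorFrom m f d ^ k * prodFrom m f ds ^ k    ≤⟨ *-mono-≤-nonNeg (^-nonNeg k (factorFrom-nonNeg f≥0 d))
                                                      (ℚ.0≤∣p∣ _) d≤ (prodFrom-^-≤-∣prodFrom∣ k ds f≥0 ds≤) ⟩
  ∣ factorFrom m′ g d ∣ * ∣ prodFrom m′ g ds ∣  ≡⟨ ℚ.∣p*q∣≡∣p∣*∣q∣ (factorFrom m′ g d) (prodFrom m′ g ds) ⟨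
  ∣ factorFrom m′ g d * prodFrom m′ g ds ∣      ≡⟨ cong ∣_∣ (prodFrom-∷ m′ g d ds) ⟨
  ∣ prodFrom m′ g (d ∷ ds) ∣                    ∎
  where open ℚ.≤-Reasoning

π-factor^4≤∣π₂-factor∣ : ∀ d → d ≢ 2 → factorFrom 2 (factor 1) d ^ 4 ≤ ∣ factorFrom 1 (factor 2) d ∣
π-factor^4≤∣π₂-factor∣ 0 _    = ℚ.≤-refl
π-factor^4≤∣π₂-factor∣ 1 _    = ℚ.≤-refl
π-factor^4≤∣π₂-factor∣ 2 d≢2  = contradiction refl d≢2
π-factor^4≤∣π₂-factor∣ d@(suc (suc (suc _))) _ =
  subst (factor 1 d ^ 4 ≤_) (sym (∣factor∣≡factor d 2≤d))
    (factor-^-≤ 4 d 1≤d 2≤d ([d-1]⁴d≤[d-2]d⁴ d (s≤s (s≤s (s≤s z≤n)))))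
  where
  1≤d = s≤s z≤n
  2≤d = s≤s (s≤s z≤n)

π-factor^9≤∣π₃-factor∣ : ∀ d → d ≢ 3 → factorFrom 2 (factor 1) d ^ 9 ≤ ∣ factorFrom 2 (factor 3) d ∣
π-factor^9≤∣π₃-factor∣ 0 _    = ℚ.≤-refl
π-factor^9≤∣π₃-factor∣ 1 _    = ℚ.≤-refl
π-factor^9≤∣π₃-factor∣ 2 _    = toWitness {a? = factor 1 2 ^ 9 ℚ.≤? ∣ factor 3 2 ∣} _
π-factor^9≤∣π₃-factor∣ 3 d≢3  = contradiction refl d≢3
π-factor^9≤∣π₃-factor∣ d@(suc (suc (suc (suc _)))) _ =
  subst (factor 1 d ^ 9 ≤_) (sym (∣factor∣≡factor d 3≤d))
    (factor-^-≤ 9 d 1≤d 3≤d ([d-1]⁹d≤[d-3]d⁹ d (s≤s (s≤s (s≤s (s≤s z≤n))))))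
  where
  1≤d = s≤s z≤n
  3≤d = s≤s (s≤s (s≤s z≤n))

positions-<rank : ∀ v {d} → d ∈ positions v → d ℕ.< rank v
positions-<rank (one ∷ v) d∈ = ℕ.m<n⇒m<1+n (positions-<rank v d∈)
positions-<rank (two ∷ v) (here refl) = ℕ.n<1+n (suc (rank v))
positions-<rank (two ∷ v) (there d∈) = ℕ.m<n⇒m<1+n (ℕ.m<n⇒m<1+n (positions-<rank v d∈))

positions-positive : ∀ v {d} → d ∈ positions v → 0 ℕ.< d
positions-positive (one ∷ v) d∈ = positions-positive v d∈
positions-positive (two ∷ v) (here refl) = ℕ.z<s
positions-positive (two ∷ v) (there d∈) = positions-positive v d∈

positions-no-neighbours : ∀ v {d} → d ∈ positions v → suc d ∉ positions v
positions-no-neighbours (one ∷ v) d∈ = positions-no-neighbours v d∈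
positions-no-neighbours (two ∷ v) (here refl) (here d+1≡d) = ℕ.1+n≢n (ℕ.suc-injective d+1≡d)
positions-no-neighbours (two ∷ v) (here refl) (there d+1∈) =
  ℕ.≤⇒≯ (ℕ.m≤n+m (rank v) 2) (positions-<rank v d+1∈)
positions-no-neighbours (two ∷ v) (there d∈) (here refl) = ℕ.<-irrefl refl (positions-<rank v d∈)
positions-no-neighbours (two ∷ v) (there d∈) (there d+1∈) = positions-no-neighbours v d∈ d+1∈

-- d₁ v unfolds to least (positions v).
least : List ℕ → Maybe ℕ
least = foldr (λ d m → just (maybe (ℕ._⊓ d) d m)) nothing

least-≤ : ∀ {x xs} → x ∈ xs → ∃[ m ] least xs ≡ just m × m ℕ.≤ x
least-≤ {xs = y ∷ ys} (here refl) with least ys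
... | nothing = y , refl , ℕ.≤-refl
... | just m  = m ℕ.⊓ y , refl , ℕ.m⊓n≤n m y
least-≤ {xs = y ∷ ys} (there x∈ys) with least-≤ x∈ys
... | m , ys-least , m≤x =
  m ℕ.⊓ y , cong (λ l → just (maybe (ℕ._⊓ y) y l)) ys-least , ℕ.≤-trans (ℕ.m⊓n≤m m y) m≤x

least-∈ : ∀ {m} xs → least xs ≡ just m → m ∈ xs
least-∈ (y ∷ ys) eq with least ys in ys-least
... | nothing = here (sym (just-injective eq))
... | just m′ with ℕ.⊓-sel m′ y
...   | inj₁ m′⊓y≡m′ = there (least-∈ ys (trans ys-least (cong just (trans (sym m′⊓y≡m′) (just-injective eq)))))
...   | inj₂ m′⊓y≡y  = here (trans (sym (just-injective eq)) m′⊓y≡y)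

2∈positions⇒d₁≡2 : ∀ v → 2 ∈ positions v → d₁ v ≡ just 2
2∈positions⇒d₁≡2 v 2∈ with least-≤ 2∈
... | m , d₁≡m , m≤2 with least-∈ (positions v) d₁≡m | m≤2
...   | m∈ | z≤n           = contradiction (positions-positive v m∈) λ ()
...   | m∈ | s≤s z≤n       = contradiction 2∈ (positions-no-neighbours v m∈)
...   | _  | s≤s (s≤s z≤n) = d₁≡m

d₁≡2⇒3∉positions : ∀ v → d₁ v ≡ just 2 → 3 ∉ positions v
d₁≡2⇒3∉positions v d₁≡2 = positions-no-neighbours v (least-∈ (positions v) d₁≡2)

lemma8p4 : (v : FibWord) →
    ((d₁ v ≢ just 2) → ∣ π[ 2 ] v ∣ ≥ π v ^ 4) ×
    ((d₁ v ≡ just 2) → ∣ π[ 3 ] v ∣ ≥ π v ^ 9)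
lemma8p4 v = case-d₁≢2 , case-d₁≡2
  where
  factor1-nonNeg : ∀ {d} → 2 ℕ.≤ d → 0ℚ ≤ factor 1 d
  factor1-nonNeg {d} 2≤d = factor-nonNeg d (ℕ.≤-trans (s≤s z≤n) 2≤d)

  case-d₁≢2 : d₁ v ≢ just 2 → π v ^ 4 ≤ ∣ π[ 2 ] v ∣
  case-d₁≢2 d₁≢2 = prodFrom-^-≤-∣prodFrom∣ 4 (positions v) factor1-nonNeg (All.tabulate λ {d} d∈ →
    π-factor^4≤∣π₂-factor∣ d λ { refl → d₁≢2 (2∈positions⇒d₁≡2 v d∈) })

  case-d₁≡2 : d₁ v ≡ just 2 → π v ^ 9 ≤ ∣ π[ 3 ] v ∣
  case-d₁≡2 d₁≡2 = prodFrom-^-≤-∣prodFrom∣ 9 (positions v) factor1-nonNeg (All.tabulate λ {d} d∈ →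
    π-factor^9≤∣π₃-factor∣ d λ { refl → d₁≡2⇒3∉positions v d₁≡2 d∈ })
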